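{- Let $p$ and $r$ be non-negative integers with $p \geq r+2$. For a positive integer $n$, let $a_{r}(n,p)$ denote the total number of parts congruent to $-r \pmod{p}$, counted over all partitions of $n$ into distinct parts. Let $g_{r,o}(n,p)$ (resp. $g_{r,e}(n,p)$) denote the number of partitions of $n$ in which exactly one part is repeated (all other parts appear exactly once), the multiplicity of this repeated part is at least $p-r$ and congruent to $-r$ or $-r+1 \pmod{p}$, and the repeated part is odd (resp. even). Then for all $n \geq 1$, $$a_{r}(n,p) = g_{r,o}(n,p) - g_{r,e}(n,p).$$
   Context: A partition of $n$ is a non-increasing sequence of positive integers (parts) summing to $n$; the multiplicity of a part is the number of times it appears. -}

module Defs where

open import Data.Nat using (ℕ; zero; suc; _+_; _*_; _∸_; _≤ᵇ_; _≡ᵇ_)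
open import Data.Nat.Divisibility using (_∣?_)
open import Data.Bool using (Bool; true; false; _∧_; _∨_; not)
open import Data.List using (List; []; _∷_; [_]; map; concatMap; upTo; filterᵇ; length)
open import Data.Nat.ListAction using (sum)
open import Data.Bool.ListAction using (all)
open import Data.Vec using (Vec; []; _∷_)
open import Data.Product using (_×_; _,_)
open import Relation.Nullary.Decidable using (⌊_⌋)

-- A partition of n is encoded by its multiplicity vector
--   (m₁, …, mₙ) : Vec ℕ n,  m_j = multiplicity of the part j,
-- subject to  Σ j · m_j = n.  (Every part of a partition of n is ≤ n,
-- and every multiplicity is ≤ n.)  This is a bijection with the
-- non-increasing sequences of positive integers summing to n.

allVecs : (k b : ℕ) → List (Vec ℕ k)
allVecs zero    b = [ [] ]
allVecs (suc k) b = concatMap (λ x → map (x ∷_) (allVecs k b)) (upTo (suc b))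

entries : ∀ {k} → ℕ → Vec ℕ k → List (ℕ × ℕ)
entries s []       = []
entries s (m ∷ ms) = (s , m) ∷ entries (suc s) ms

size : List (ℕ × ℕ) → ℕ
size []            = 0
size ((j , m) ∷ e) = j * m + size e

partitions : ℕ → List (List (ℕ × ℕ))
partitions n = filterᵇ (λ e → size e ≡ᵇ n) (map (entries 1) (allVecs n n))

_∣ᵇ_ : ℕ → ℕ → Bool
p ∣ᵇ x = ⌊ p ∣? x ⌋

isDistinct : List (ℕ × ℕ) → Bool
isDistinct = all (λ { (j , m) → m ≤ᵇ 1 })

partsCong : (p r : ℕ) → List (ℕ × ℕ) → ℕ
partsCong p r []            = 0
partsCong p r ((j , m) ∷ e) = (if p ∣ᵇ (j + r) then m else 0) + partsCong p r e
  where open import Data.Bool using (if_then_else_)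

a : (r n p : ℕ) → ℕ
a r n p = sum (map (partsCong p r) (filterᵇ isDistinct (partitions n)))

repeated : List (ℕ × ℕ) → List (ℕ × ℕ)
repeated = filterᵇ (λ { (j , m) → 2 ≤ᵇ m })

-- exactly one part repeated, with multiplicity m satisfying
-- m ≥ p - r and m ≡ -r or -r+1 (mod p), i.e. p ∣ m + r or p ∣ m + r - 1
-- (m + r ≥ 2 here, so the truncated subtraction is exact);
-- the flag `wantOdd` selects whether the repeated part must be odd or even
gCond : (p r : ℕ) → (wantOdd : Bool) → List (ℕ × ℕ) → Bool
gCond p r wantOdd e with repeated e
... | (j , m) ∷ [] = ((p ∸ r) ≤ᵇ m)
                     ∧ ((p ∣ᵇ (m + r)) ∨ (p ∣ᵇ (m + r ∸ 1)))
                     ∧ (isOdd j ≡ᵇᵇ wantOdd)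
  where
    isOdd : ℕ → Bool
    isOdd zero          = false
    isOdd (suc zero)    = true
    isOdd (suc (suc k)) = isOdd k
    _≡ᵇᵇ_ : Bool → Bool → Bool
    true  ≡ᵇᵇ b = b
    false ≡ᵇᵇ b = not b
... | _ = false

g-o : (r n p : ℕ) → ℕ
g-o r n p = length (filterᵇ (gCond p r true) (partitions n))

g-e : (r n p : ℕ) → ℕ
g-e r n p = length (filterᵇ (gCond p r false) (partitions n))

-- Put w(λ) = [λ distinct]·#{parts ≡ −r} − [λ counted by g_{r,o}] + [λ counted by g_{r,e}]; the claim is
-- Σ_{λ ⊢ n} w(λ) = 0.  Behind it is q^K/(1 + q^K) = Σ_{j ≥ 1} (−1)^(j+1) q^(jK) read in both directions: a part
-- K ≡ −r (K ≥ p − r) of a distinct partition is traded for an alternating sum over partitions repeating a part j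
-- exactly K times.  To make this finite, fix the multiplicities of the parts one at a time, from n down to 1.
-- With D_s(x) the number of partitions of x into distinct parts from [s, n], the sum of w over the partitions
-- of n − c into parts from [t + 1, n] is
--     (Σ_{j ≤ t < K} − Σ_{K ≤ t < j}) [K ≡ −r, K ≥ p − r] (−1)^(j+1) D_{t+1}(n − c − jK)     (j, K ∈ [1, n]),
-- which is empty for t = 0.  Bringing in the part s = t, and using D_s(x) = D_{s+1}(x) + D_{s+1}(x − s), the new
-- terms with K = s telescope in j to the distinct partitions containing s once, and the new terms with j = s pair
-- the multiplicities K and K + 1 into the condition "≡ −r or −r + 1" on the multiplicity of a repeated part s.

module Submission where

open import Defs
open import Data.Bool using (Bool; true; false; _∧_; _∨_; if_then_else_)
open import Data.Bool.Properties using (∧-zeroʳ; ∧-identityʳ; ∨-identityʳ; T-≡)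
open import Data.Empty using (⊥; ⊥-elim)
open import Data.List using (List; []; _∷_; _++_; map; concatMap; filterᵇ; length; null; upTo; applyUpTo)
open import Data.Nat as ℕ using (ℕ; zero; suc; _∸_; _≤_; _<_; _≤ᵇ_; _≡ᵇ_; s≤s; z≤n)
import Data.Nat.Properties as ℕₚ
open import Data.Nat.Divisibility using (_∣_; _∣?_; ∣⇒≤; ∣1⇒≡1; ∣m+n∣m⇒∣n)
open import Data.Nat.ListAction using (sum)
open import Data.Product using (_×_; _,_)
import Data.Vec as Vec
open import Data.Integer using (ℤ; +_; _-_)
import Data.Integer.Properties as ℤ
open import Data.Integer.Tactic.RingSolver using (solve-∀)
open import Function using (_∘_)
open import Function.Bundles using (Equivalence)
open import Relation.Nullary using (¬_)
open import Relation.Nullary.Decidable using (toWitness)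
open import Relation.Binary.PropositionalEquality

<⇒≤ᵇ≡false : ∀ {m n} → n < m → (m ≤ᵇ n) ≡ false
<⇒≤ᵇ≡false {m} {n} n<m with m ≤ᵇ n in eq
... | true  = ⊥-elim (ℕₚ.<⇒≱ n<m (ℕₚ.≤ᵇ⇒≤ m n (Equivalence.from T-≡ eq)))
... | false = refl

∣ᵇ⇒∣ : ∀ {d x} → d ∣ᵇ x ≡ true → d ∣ x
∣ᵇ⇒∣ {d} {x} eq = toWitness {a? = d ∣? x} (Equivalence.from T-≡ eq)

module Sums where

  open import Data.Integer using (_+_; _*_; -_; 0ℤ; 1ℤ; -1ℤ)

  ⟦_⟧ : Bool → ℤ
  ⟦ true ⟧  = 1ℤ
  ⟦ false ⟧ = 0ℤ

  if-same : ∀ b (x : ℤ) → (if b then x else x) ≡ x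
  if-same true  x = refl
  if-same false x = refl

  if-+ : ∀ b (x y : ℤ) → (if b then x + y else 0ℤ) ≡ (if b then x else 0ℤ) + (if b then y else 0ℤ)
  if-+ true  x y = refl
  if-+ false x y = refl

  if-* : ∀ b (a x : ℤ) → (if b then a * x else 0ℤ) ≡ a * (if b then x else 0ℤ)
  if-* true  a x = refl
  if-* false a x = sym (ℤ.*-zeroʳ a)

  ∑ₗ : {A : Set} → List A → (A → ℤ) → ℤ
  ∑ₗ []       f = 0ℤ
  ∑ₗ (x ∷ xs) f = f x + ∑ₗ xs f

  syntax ∑ₗ xs (λ x → e) = ∑[ x ∈ xs ] e

  ∑< : ℕ → (ℕ → ℤ) → ℤ
  ∑< zero    f = 0ℤ
  ∑< (suc n) f = f 0 + ∑< n (f ∘ suc)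

  syntax ∑< n (λ i → e) = ∑[ i < n ] e

  private
    interchange : ∀ a b c d → (a + b) + (c + d) ≡ (a + c) + (b + d)
    interchange = solve-∀

    interchange⁻ : ∀ a b c d → (a - b) + (c - d) ≡ (a + c) - (b + d)
    interchange⁻ = solve-∀

    distrib : ∀ a b c → a * b + a * c ≡ a * (b + c)
    distrib a b c = sym (ℤ.*-distribˡ-+ a b c)

  module _ {A : Set} where

    ∑ₗ-cong : ∀ (xs : List A) {f g : A → ℤ} → (∀ x → f x ≡ g x) → ∑ₗ xs f ≡ ∑ₗ xs g
    ∑ₗ-cong []       f≗g = refl
    ∑ₗ-cong (x ∷ xs) f≗g = cong₂ _+_ (f≗g x) (∑ₗ-cong xs f≗g)

    ∑ₗ-zero : ∀ (xs : List A) → ∑[ x ∈ xs ] 0ℤ ≡ 0ℤ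
    ∑ₗ-zero []       = refl
    ∑ₗ-zero (x ∷ xs) = trans (ℤ.+-identityˡ _) (∑ₗ-zero xs)

    ∑ₗ-+ : ∀ (xs : List A) (f g : A → ℤ) → ∑[ x ∈ xs ] (f x + g x) ≡ ∑ₗ xs f + ∑ₗ xs g
    ∑ₗ-+ []       f g = refl
    ∑ₗ-+ (x ∷ xs) f g = trans (cong (_+_ (f x + g x)) (∑ₗ-+ xs f g)) (interchange (f x) (g x) (∑ₗ xs f) (∑ₗ xs g))

    ∑ₗ-minus : ∀ (xs : List A) (f g : A → ℤ) → ∑[ x ∈ xs ] (f x - g x) ≡ ∑ₗ xs f - ∑ₗ xs g
    ∑ₗ-minus []       f g = refl
    ∑ₗ-minus (x ∷ xs) f g = trans (cong (_+_ (f x - g x)) (∑ₗ-minus xs f g)) (interchange⁻ (f x) (g x) (∑ₗ xs f) (∑ₗ xs g))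

    ∑ₗ-* : ∀ (xs : List A) a (f : A → ℤ) → ∑[ x ∈ xs ] (a * f x) ≡ a * ∑ₗ xs f
    ∑ₗ-* []       a f = sym (ℤ.*-zeroʳ a)
    ∑ₗ-* (x ∷ xs) a f = trans (cong (_+_ (a * f x)) (∑ₗ-* xs a f)) (distrib a (f x) (∑ₗ xs f))

    ∑ₗ-++ : ∀ (xs ys : List A) (f : A → ℤ) → ∑ₗ (xs ++ ys) f ≡ ∑ₗ xs f + ∑ₗ ys f
    ∑ₗ-++ []       ys f = sym (ℤ.+-identityˡ _)
    ∑ₗ-++ (x ∷ xs) ys f = trans (cong (_+_ (f x)) (∑ₗ-++ xs ys f)) (sym (ℤ.+-assoc (f x) _ _))

    ∑ₗ-map : ∀ {B : Set} (xs : List B) (h : B → A) (f : A → ℤ) → ∑ₗ (map h xs) f ≡ ∑ₗ xs (f ∘ h)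
    ∑ₗ-map []       h f = refl
    ∑ₗ-map (x ∷ xs) h f = cong (_+_ (f (h x))) (∑ₗ-map xs h f)

    ∑ₗ-concatMap : ∀ {B : Set} (xs : List B) (h : B → List A) (f : A → ℤ) →
                   ∑ₗ (concatMap h xs) f ≡ ∑[ y ∈ xs ] ∑ₗ (h y) f
    ∑ₗ-concatMap []       h f = refl
    ∑ₗ-concatMap (x ∷ xs) h f = trans (∑ₗ-++ (h x) _ f) (cong (_+_ (∑ₗ (h x) f)) (∑ₗ-concatMap xs h f))

    ∑ₗ-filterᵇ : ∀ (xs : List A) (P : A → Bool) (f : A → ℤ) →
                 ∑ₗ (filterᵇ P xs) f ≡ ∑[ x ∈ xs ] (if P x then f x else 0ℤ)
    ∑ₗ-filterᵇ []       P f = refl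
    ∑ₗ-filterᵇ (x ∷ xs) P f with P x
    ... | true  = cong (_+_ (f x)) (∑ₗ-filterᵇ xs P f)
    ... | false = trans (∑ₗ-filterᵇ xs P f) (sym (ℤ.+-identityˡ _))

    length-filterᵇ : ∀ (xs : List A) (P : A → Bool) → + length (filterᵇ P xs) ≡ ∑[ x ∈ xs ] ⟦ P x ⟧
    length-filterᵇ []       P = refl
    length-filterᵇ (x ∷ xs) P with P x
    ... | true  = cong (_+_ 1ℤ) (length-filterᵇ xs P)
    ... | false = trans (length-filterᵇ xs P) (sym (ℤ.+-identityˡ _))

    sum-map : ∀ (xs : List A) (f : A → ℕ) → + sum (map f xs) ≡ ∑[ x ∈ xs ] (+ f x)
    sum-map []       f = refl
    sum-map (x ∷ xs) f = cong (_+_ (+ f x)) (sum-map xs f)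

  ∑ₗ-applyUpTo : ∀ n (g : ℕ → ℕ) (f : ℕ → ℤ) → ∑ₗ (applyUpTo g n) f ≡ ∑< n (f ∘ g)
  ∑ₗ-applyUpTo zero    g f = refl
  ∑ₗ-applyUpTo (suc n) g f = cong (_+_ (f (g 0))) (∑ₗ-applyUpTo n (g ∘ suc) f)

  ∑ₗ-upTo : ∀ n (f : ℕ → ℤ) → ∑ₗ (upTo n) f ≡ ∑< n f
  ∑ₗ-upTo n f = ∑ₗ-applyUpTo n (λ i → i) f

  ∑<-cong< : ∀ n {f g : ℕ → ℤ} → (∀ i → i < n → f i ≡ g i) → ∑< n f ≡ ∑< n g
  ∑<-cong< zero    f≗g = refl
  ∑<-cong< (suc n) f≗g = cong₂ _+_ (f≗g 0 (s≤s z≤n)) (∑<-cong< n (λ i i<n → f≗g (suc i) (s≤s i<n)))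

  ∑<-cong : ∀ n {f g : ℕ → ℤ} → (∀ i → f i ≡ g i) → ∑< n f ≡ ∑< n g
  ∑<-cong n f≗g = ∑<-cong< n (λ i _ → f≗g i)

  ∑<-zero : ∀ n → ∑[ i < n ] 0ℤ ≡ 0ℤ
  ∑<-zero zero    = refl
  ∑<-zero (suc n) = trans (ℤ.+-identityˡ _) (∑<-zero n)

  ∑<-+ : ∀ n (f g : ℕ → ℤ) → ∑[ i < n ] (f i + g i) ≡ ∑< n f + ∑< n g
  ∑<-+ zero    f g = refl
  ∑<-+ (suc n) f g = trans (cong (_+_ (f 0 + g 0)) (∑<-+ n (f ∘ suc) (g ∘ suc)))
                           (interchange (f 0) (g 0) (∑< n (f ∘ suc)) (∑< n (g ∘ suc)))

  ∑<-minus : ∀ n (f g : ℕ → ℤ) → ∑[ i < n ] (f i - g i) ≡ ∑< n f - ∑< n g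
  ∑<-minus zero    f g = refl
  ∑<-minus (suc n) f g = trans (cong (_+_ (f 0 - g 0)) (∑<-minus n (f ∘ suc) (g ∘ suc)))
                           (interchange⁻ (f 0) (g 0) (∑< n (f ∘ suc)) (∑< n (g ∘ suc)))

  ∑<-* : ∀ n a (f : ℕ → ℤ) → ∑[ i < n ] (a * f i) ≡ a * ∑< n f
  ∑<-* zero    a f = sym (ℤ.*-zeroʳ a)
  ∑<-* (suc n) a f = trans (cong (_+_ (a * f 0)) (∑<-* n a (f ∘ suc))) (distrib a (f 0) (∑< n (f ∘ suc)))

  ∑<-neg : ∀ n (f : ℕ → ℤ) → ∑[ i < n ] (- f i) ≡ - ∑< n f
  ∑<-neg n f = trans (∑<-cong n (λ i → sym (ℤ.-1*i≡-i (f i)))) (trans (∑<-* n -1ℤ f) (ℤ.-1*i≡-i _))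

  ∑<-snoc : ∀ n (f : ℕ → ℤ) → ∑< (suc n) f ≡ ∑< n f + f n
  ∑<-snoc zero    f = ℤ.+-comm (f 0) 0ℤ
  ∑<-snoc (suc n) f = trans (cong (_+_ (f 0)) (∑<-snoc n (f ∘ suc))) (sym (ℤ.+-assoc (f 0) _ _))

  ∑<-shift : ∀ n (f : ℕ → ℤ) → f 0 ≡ 0ℤ → f n ≡ 0ℤ → ∑< n f ≡ ∑< n (f ∘ suc)
  ∑<-shift n f f0≡0 fn≡0 = begin
    ∑< n f                ≡⟨ sym (ℤ.+-identityʳ _) ⟩
    ∑< n f + 0ℤ           ≡⟨ cong (_+_ (∑< n f)) (sym fn≡0) ⟩
    ∑< n f + f n          ≡⟨ sym (∑<-snoc n f) ⟩
    f 0 + ∑< n (f ∘ suc)  ≡⟨ cong (λ z → z + ∑< n (f ∘ suc)) f0≡0 ⟩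
    0ℤ + ∑< n (f ∘ suc)   ≡⟨ ℤ.+-identityˡ _ ⟩
    ∑< n (f ∘ suc)        ∎
    where open ≡-Reasoning

  ∑<-select : ∀ n (f : ℕ → ℤ) t → t < n → ∑[ i < n ] (f i * ⟦ t ≡ᵇ i ⟧) ≡ f t
  ∑<-select (suc n) f zero    _ = begin
    f 0 * 1ℤ + ∑[ i < n ] (f (suc i) * 0ℤ)  ≡⟨ cong (_+_ (f 0 * 1ℤ)) (∑<-cong n (λ i → ℤ.*-zeroʳ (f (suc i)))) ⟩
    f 0 * 1ℤ + ∑[ i < n ] 0ℤ                ≡⟨ cong (_+_ (f 0 * 1ℤ)) (∑<-zero n) ⟩
    f 0 * 1ℤ + 0ℤ                           ≡⟨ ℤ.+-identityʳ (f 0 * 1ℤ) ⟩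
    f 0 * 1ℤ                                ≡⟨ ℤ.*-identityʳ (f 0) ⟩
    f 0                                     ∎
    where open ≡-Reasoning
  ∑<-select (suc n) f (suc t) (s≤s t<n) =
    trans (cong (λ z → z + ∑[ i < n ] (f (suc i) * ⟦ t ≡ᵇ i ⟧)) (ℤ.*-zeroʳ (f 0)))
          (trans (ℤ.+-identityˡ (∑[ i < n ] (f (suc i) * ⟦ t ≡ᵇ i ⟧))) (∑<-select n (f ∘ suc) t t<n))

  -- sign j = (−1)^(j+1)
  sign : ℕ → ℤ
  sign zero    = -1ℤ
  sign (suc j) = - sign j

  ∑-alternating-telescope : ∀ n (v : ℕ → ℤ) → ∑[ i < n ] (sign (suc i) * (v i + v (suc i))) ≡ v 0 + sign n * v n
  ∑-alternating-telescope zero    v = vanishing (v 0)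
    where
      vanishing : ∀ a → 0ℤ ≡ a + -1ℤ * a
      vanishing = solve-∀
  ∑-alternating-telescope (suc n) v = begin
      1ℤ * (v 0 + v 1) + ∑[ i < n ] (- sign (suc i) * w i)
    ≡⟨ cong (_+_ (1ℤ * (v 0 + v 1))) (trans (∑<-cong n (λ i → sym (ℤ.neg-distribˡ-* (sign (suc i)) (w i))))
                                             (∑<-neg n (λ i → sign (suc i) * w i))) ⟩
      1ℤ * (v 0 + v 1) + - ∑[ i < n ] (sign (suc i) * w i)
    ≡⟨ cong (λ z → 1ℤ * (v 0 + v 1) + - z) (∑-alternating-telescope n (v ∘ suc)) ⟩
      1ℤ * (v 0 + v 1) + - (v 1 + sign n * v (suc n))
    ≡⟨ cancel (v 0) (v 1) (sign n) (v (suc n)) ⟩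
      v 0 + - sign n * v (suc n)
    ∎
    where
      open ≡-Reasoning
      w : ℕ → ℤ
      w i = v (suc i) + v (suc (suc i))
      cancel : ∀ a b s c → 1ℤ * (a + b) + - (b + s * c) ≡ a + - s * c
      cancel = solve-∀

  ≤ᵇ-split : ∀ m n → ⟦ m ≤ᵇ n ⟧ ≡ ⟦ m ≡ᵇ n ⟧ + ⟦ suc m ≤ᵇ n ⟧
  ≤ᵇ-split zero          zero    = refl
  ≤ᵇ-split zero          (suc n) = refl
  ≤ᵇ-split (suc m)       zero    = refl
  ≤ᵇ-split (suc zero)    (suc n) = ≤ᵇ-split zero n
  ≤ᵇ-split (suc (suc m)) (suc n) = ≤ᵇ-split (suc m) n

  cutSum : ℕ → (ℕ → ℕ → ℤ) → ℕ → ℤ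
  cutSum n f t = ∑[ j < n ] ∑[ k < n ] (f j k * (⟦ t ≤ᵇ k ⟧ - ⟦ t ≤ᵇ j ⟧))

  cutSum-cong : ∀ n t {f g : ℕ → ℕ → ℤ} → (∀ j k → f j k ≡ g j k) → cutSum n f t ≡ cutSum n g t
  cutSum-cong n t f≗g = ∑<-cong n (λ j → ∑<-cong n (λ k → cong (λ x → x * (⟦ t ≤ᵇ k ⟧ - ⟦ t ≤ᵇ j ⟧)) (f≗g j k)))

  cutSum-+ : ∀ n t (f g : ℕ → ℕ → ℤ) → cutSum n (λ j k → f j k + g j k) t ≡ cutSum n f t + cutSum n g t
  cutSum-+ n t f g = trans
    (∑<-cong n (λ j → trans (∑<-cong n (λ k → ℤ.*-distribʳ-+ (c j k) (f j k) (g j k)))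
                             (∑<-+ n (λ k → f j k * c j k) (λ k → g j k * c j k))))
    (∑<-+ n (λ j → ∑[ k < n ] (f j k * c j k)) (λ j → ∑[ k < n ] (g j k * c j k)))
    where
      c : ℕ → ℕ → ℤ
      c j k = ⟦ t ≤ᵇ k ⟧ - ⟦ t ≤ᵇ j ⟧

  cutSum-zero : ∀ n (f : ℕ → ℕ → ℤ) → cutSum n f 0 ≡ 0ℤ
  cutSum-zero n f = trans
    (∑<-cong n (λ j → trans (∑<-cong n (λ k → ℤ.*-zeroʳ (f j k))) (∑<-zero n)))
    (∑<-zero n)

  cutSum-full : ∀ n (f : ℕ → ℕ → ℤ) → cutSum n f n ≡ 0ℤ
  cutSum-full n f =
    trans (∑<-cong< n (λ j j<n → trans (∑<-cong< n (λ k k<n → vanish j k j<n k<n)) (∑<-zero n))) (∑<-zero n)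
    where
      vanish : ∀ j k → j < n → k < n → f j k * (⟦ n ≤ᵇ k ⟧ - ⟦ n ≤ᵇ j ⟧) ≡ 0ℤ
      vanish j k j<n k<n rewrite <⇒≤ᵇ≡false k<n | <⇒≤ᵇ≡false j<n = ℤ.*-zeroʳ (f j k)

  cutSum-suc : ∀ n (f : ℕ → ℕ → ℤ) t → t < n →
               cutSum n f t ≡ cutSum n f (suc t) + (∑[ j < n ] f j t - ∑[ k < n ] f t k)
  cutSum-suc n f t t<n = begin
      cutSum n f t
    ≡⟨ ∑<-cong n (λ j → ∑<-cong n (λ k → split j k)) ⟩
      ∑[ j < n ] ∑[ k < n ] (A j k + (f j k * ⟦ t ≡ᵇ k ⟧ - ⟦ t ≡ᵇ j ⟧ * f j k))
    ≡⟨ ∑<-cong n row ⟩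
      ∑[ j < n ] (∑< n (A j) + (f j t - ⟦ t ≡ᵇ j ⟧ * ∑< n (f j)))
    ≡⟨ ∑<-+ n (λ j → ∑< n (A j)) (λ j → f j t - ⟦ t ≡ᵇ j ⟧ * ∑< n (f j)) ⟩
      cutSum n f (suc t) + ∑[ j < n ] (f j t - ⟦ t ≡ᵇ j ⟧ * ∑< n (f j))
    ≡⟨ cong (_+_ (cutSum n f (suc t)))
            (trans (∑<-minus n (λ j → f j t) (λ j → ⟦ t ≡ᵇ j ⟧ * ∑< n (f j))) (cong (_-_ (∑[ j < n ] f j t)) column)) ⟩
      cutSum n f (suc t) + (∑[ j < n ] f j t - ∑[ k < n ] f t k)
    ∎
    where
      open ≡-Reasoning
      A : ℕ → ℕ → ℤ
      A j k = f j k * (⟦ suc t ≤ᵇ k ⟧ - ⟦ suc t ≤ᵇ j ⟧)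
      regroup : ∀ x e₁ l₁ e₂ l₂ → x * ((e₁ + l₁) - (e₂ + l₂)) ≡ x * (l₁ - l₂) + (x * e₁ - e₂ * x)
      regroup = solve-∀
      split : ∀ j k → f j k * (⟦ t ≤ᵇ k ⟧ - ⟦ t ≤ᵇ j ⟧) ≡ A j k + (f j k * ⟦ t ≡ᵇ k ⟧ - ⟦ t ≡ᵇ j ⟧ * f j k)
      split j k rewrite ≤ᵇ-split t k | ≤ᵇ-split t j =
        regroup (f j k) ⟦ t ≡ᵇ k ⟧ ⟦ suc t ≤ᵇ k ⟧ ⟦ t ≡ᵇ j ⟧ ⟦ suc t ≤ᵇ j ⟧
      row : ∀ j → ∑[ k < n ] (A j k + (f j k * ⟦ t ≡ᵇ k ⟧ - ⟦ t ≡ᵇ j ⟧ * f j k))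
                ≡ ∑< n (A j) + (f j t - ⟦ t ≡ᵇ j ⟧ * ∑< n (f j))
      row j = trans (∑<-+ n (A j) (λ k → f j k * ⟦ t ≡ᵇ k ⟧ - ⟦ t ≡ᵇ j ⟧ * f j k)) (cong (_+_ (∑< n (A j)))
                (trans (∑<-minus n (λ k → f j k * ⟦ t ≡ᵇ k ⟧) (λ k → ⟦ t ≡ᵇ j ⟧ * f j k))
                       (cong₂ _-_ (∑<-select n (f j) t t<n) (∑<-* n ⟦ t ≡ᵇ j ⟧ (f j)))))
      column : ∑[ j < n ] (⟦ t ≡ᵇ j ⟧ * ∑< n (f j)) ≡ ∑[ k < n ] f t k
      column = trans (∑<-cong n (λ j → ℤ.*-comm ⟦ t ≡ᵇ j ⟧ (∑< n (f j)))) (∑<-select n (λ j → ∑< n (f j)) t t<n)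

  iverson-∧-∨ : ∀ a a′ A B → (a′ ≡ true → a ≡ true) → (A ≡ true → B ≡ true → ⊥) → (B ≡ true → a′ ≡ true) →
                ⟦ a ∧ (A ∨ B) ⟧ ≡ ⟦ a ∧ A ⟧ + ⟦ a′ ∧ B ⟧
  iverson-∧-∨ a     false A     true  _    _    B⇒a′ with () ← B⇒a′ refl
  iverson-∧-∨ a     true  true  true  _    ¬A∧B _    = ⊥-elim (¬A∧B refl refl)
  iverson-∧-∨ false true  false true  a′⇒a _    _    with () ← a′⇒a refl
  iverson-∧-∨ true  true  false true  _    _    _    = refl
  iverson-∧-∨ a     a′    A     false _    _    _    rewrite ∨-identityʳ A | ∧-zeroʳ a′ = sym (ℤ.+-identityʳ _)

module Weights (p r : ℕ) where

  open import Data.Integer using (_+_; _*_; -_; 0ℤ)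
  open Sums

  negResidue : ℕ → Bool
  negResidue K = (p ∸ r ≤ᵇ K) ∧ (p ∣ᵇ (K ℕ.+ r))

  allowedMult : ℕ → Bool
  allowedMult zero             = false
  allowedMult (suc zero)       = false
  allowedMult m@(suc (suc _))  = (p ∸ r ≤ᵇ m) ∧ ((p ∣ᵇ (m ℕ.+ r)) ∨ (p ∣ᵇ (m ℕ.+ r ∸ 1)))

  distinctWeight : List (ℕ × ℕ) → ℤ
  distinctWeight e = if isDistinct e then + partsCong p r e else 0ℤ

  gWeight : List (ℕ × ℕ) → ℤ
  gWeight e = ⟦ gCond p r true e ⟧ - ⟦ gCond p r false e ⟧

  weight : List (ℕ × ℕ) → ℤ
  weight e = distinctWeight e - gWeight e

  headWeight : ℕ → ℕ → ℤ
  headWeight s zero            = 0ℤ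
  headWeight s (suc zero)      = ⟦ p ∣ᵇ (s ℕ.+ r) ⟧
  headWeight s m@(suc (suc _)) = - (sign s * ⟦ allowedMult m ⟧)

  -- the j-th term of [K ≡ −r, K ≥ p − r] q^K/(1 + q^K) = Σ_j (−1)^(j+1) q^(jK), applied to D at offset c
  term : (ℕ → ℤ) → ℕ → ℕ → ℕ → ℤ
  term D c j K = ⟦ negResidue K ⟧ * (sign j * D (c ℕ.+ j ℕ.* K))

  ∑-weight : ∀ n → ∑[ e ∈ partitions n ] weight e ≡ + a r n p - (+ g-o r n p - + g-e r n p)
  ∑-weight n = begin
      ∑[ e ∈ partitions n ] weight e
    ≡⟨ ∑ₗ-minus (partitions n) distinctWeight gWeight ⟩
      ∑ₗ (partitions n) distinctWeight - ∑ₗ (partitions n) gWeight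
    ≡⟨ cong₂ _-_ distinct-part (∑ₗ-minus (partitions n) (λ e → ⟦ gCond p r true e ⟧) (λ e → ⟦ gCond p r false e ⟧)) ⟩
      + a r n p - (∑[ e ∈ partitions n ] ⟦ gCond p r true e ⟧ - ∑[ e ∈ partitions n ] ⟦ gCond p r false e ⟧)
    ≡⟨ cong (_-_ (+ a r n p)) (sym (cong₂ _-_ (length-filterᵇ (partitions n) (gCond p r true))
                                                      (length-filterᵇ (partitions n) (gCond p r false)))) ⟩
      + a r n p - (+ g-o r n p - + g-e r n p)
    ∎
    where
      open ≡-Reasoning
      distinct-part : ∑ₗ (partitions n) distinctWeight ≡ + a r n p
      distinct-part = sym (trans (sum-map (filterᵇ isDistinct (partitions n)) (partsCong p r))
                                 (∑ₗ-filterᵇ (partitions n) isDistinct (λ e → + partsCong p r e)))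

  gCond-cong : ∀ w e e′ → repeated e ≡ repeated e′ → gCond p r w e ≡ gCond p r w e′
  gCond-cong w e e′ eq with repeated e | repeated e′ | eq
  ... | _ | _ | refl = refl

  gCond-two : ∀ w e x y ys → repeated e ≡ x ∷ y ∷ ys → gCond p r w e ≡ false
  gCond-two w e x y ys eq with repeated e | eq
  ... | _ | refl = refl

  gWeight-cong : ∀ e e′ → repeated e ≡ repeated e′ → gWeight e ≡ gWeight e′
  gWeight-cong e e′ eq = cong₂ (λ x y → ⟦ x ⟧ - ⟦ y ⟧) (gCond-cong true e e′ eq) (gCond-cong false e e′ eq)

  private
    odd-part : ∀ A B → ⟦ A ∧ (B ∧ true) ⟧ - ⟦ A ∧ (B ∧ false) ⟧ ≡ sign 1 * ⟦ A ∧ B ⟧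
    odd-part true  true  = refl
    odd-part true  false = refl
    odd-part false B     = refl

    even-part : ∀ A B → ⟦ A ∧ (B ∧ false) ⟧ - ⟦ A ∧ (B ∧ true) ⟧ ≡ sign 0 * ⟦ A ∧ B ⟧
    even-part true  true  = refl
    even-part true  false = refl
    even-part false B     = refl

  gWeight-single : ∀ s m → gWeight ((s , suc (suc m)) ∷ []) ≡ sign s * ⟦ allowedMult (suc (suc m)) ⟧
  gWeight-single zero          m = even-part (p ∸ r ≤ᵇ suc (suc m)) ((p ∣ᵇ (suc (suc m) ℕ.+ r)) ∨ (p ∣ᵇ (suc m ℕ.+ r)))
  gWeight-single (suc zero)    m = odd-part (p ∸ r ≤ᵇ suc (suc m)) ((p ∣ᵇ (suc (suc m) ℕ.+ r)) ∨ (p ∣ᵇ (suc m ℕ.+ r)))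
  gWeight-single (suc (suc s)) m =
    trans (gWeight-single s m) (cong (_* ⟦ allowedMult (suc (suc m)) ⟧) (sym (ℤ.neg-involutive (sign s))))

  isDistinct-null : ∀ e → isDistinct e ≡ null (repeated e)
  isDistinct-null []                      = refl
  isDistinct-null ((j , zero) ∷ e)        = isDistinct-null e
  isDistinct-null ((j , suc zero) ∷ e)    = isDistinct-null e
  isDistinct-null ((j , suc (suc m)) ∷ e) = refl

  distinctWeight-∷₀ : ∀ s e → distinctWeight ((s , 0) ∷ e) ≡ distinctWeight e
  distinctWeight-∷₀ s e with isDistinct e | p ∣ᵇ (s ℕ.+ r)
  ... | true  | true  = refl
  ... | true  | false = refl
  ... | false | _     = refl

  distinctWeight-∷₁ : ∀ s e → distinctWeight ((s , 1) ∷ e) ≡ ⟦ p ∣ᵇ (s ℕ.+ r) ⟧ * ⟦ isDistinct e ⟧ + distinctWeight e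
  distinctWeight-∷₁ s e with isDistinct e | p ∣ᵇ (s ℕ.+ r)
  ... | true  | true  = refl
  ... | true  | false = refl
  ... | false | true  = refl
  ... | false | false = refl

  gWeight-∷₂ : ∀ s m e → gWeight ((s , suc (suc m)) ∷ e) ≡ sign s * ⟦ allowedMult (suc (suc m)) ⟧ * ⟦ isDistinct e ⟧
  gWeight-∷₂ s m e = by-repeated (repeated e) refl
    where
      open ≡-Reasoning
      h : ℕ × ℕ
      h = (s , suc (suc m))
      σW : ℤ
      σW = sign s * ⟦ allowedMult (suc (suc m)) ⟧
      distinct : ∀ {l} → repeated e ≡ l → isDistinct e ≡ null l
      distinct eq = trans (isDistinct-null e) (cong null eq)
      by-repeated : ∀ l → repeated e ≡ l → gWeight (h ∷ e) ≡ σW * ⟦ isDistinct e ⟧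
      by-repeated [] eq = begin
          gWeight (h ∷ e)        ≡⟨ gWeight-cong (h ∷ e) (h ∷ []) (cong (h ∷_) eq) ⟩
          gWeight (h ∷ [])       ≡⟨ gWeight-single s m ⟩
          σW                     ≡⟨ sym (ℤ.*-identityʳ σW) ⟩
          σW * ⟦ true ⟧          ≡⟨ cong (λ b → σW * ⟦ b ⟧) (sym (distinct eq)) ⟩
          σW * ⟦ isDistinct e ⟧  ∎
      by-repeated (x ∷ xs) eq = begin
          gWeight (h ∷ e)        ≡⟨ cong₂ (λ b c → ⟦ b ⟧ - ⟦ c ⟧) (gCond-two true (h ∷ e) h x xs (cong (h ∷_) eq))
                                                               (gCond-two false (h ∷ e) h x xs (cong (h ∷_) eq)) ⟩
          0ℤ                     ≡⟨ sym (ℤ.*-zeroʳ σW) ⟩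
          σW * ⟦ false ⟧         ≡⟨ cong (λ b → σW * ⟦ b ⟧) (sym (distinct eq)) ⟩
          σW * ⟦ isDistinct e ⟧  ∎

  weight-∷ : ∀ s m e → weight ((s , m) ∷ e) ≡ (if m ≤ᵇ 1 then weight e else 0ℤ) + headWeight s m * ⟦ isDistinct e ⟧
  weight-∷ s zero e =
    trans (cong₂ _-_ (distinctWeight-∷₀ s e) (gWeight-cong ((s , 0) ∷ e) e refl)) (sym (ℤ.+-identityʳ (weight e)))
  weight-∷ s (suc zero) e =
    trans (cong (λ x → x - gWeight e) (distinctWeight-∷₁ s e))
          (rotate (⟦ p ∣ᵇ (s ℕ.+ r) ⟧ * ⟦ isDistinct e ⟧) (distinctWeight e) (gWeight e))
    where
      rotate : ∀ x y z → (x + y) - z ≡ (y - z) + x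
      rotate = solve-∀
  weight-∷ s (suc (suc m)) e =
    trans (cong (_-_ 0ℤ) (gWeight-∷₂ s m e)) (negate (sign s * ⟦ allowedMult (suc (suc m)) ⟧) ⟦ isDistinct e ⟧)
    where
      negate : ∀ x y → 0ℤ - x * y ≡ 0ℤ + (- x) * y
      negate = solve-∀

  ∑-headWeight : ∀ ℓ s (τ : ℕ → ℤ) →
                 ∑[ x < suc (suc ℓ) ] (headWeight s x * τ x)
                   ≡ ⟦ p ∣ᵇ (s ℕ.+ r) ⟧ * τ 1 - sign s * ∑[ x < suc (suc ℓ) ] (⟦ allowedMult x ⟧ * τ x)
  ∑-headWeight ℓ s τ = begin
      0ℤ + (d * τ 1 + ∑[ y < ℓ ] (headWeight s (suc (suc y)) * τ (suc (suc y))))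
    ≡⟨ cong (λ z → 0ℤ + (d * τ 1 + z)) high ⟩
      0ℤ + (d * τ 1 + - (sign s * P))
    ≡⟨ regroup (d * τ 1) (sign s) P ⟩
      d * τ 1 - sign s * (0ℤ + (0ℤ + P))
    ∎
    where
      open ≡-Reasoning
      d : ℤ
      d = ⟦ p ∣ᵇ (s ℕ.+ r) ⟧
      W : ℕ → ℤ
      W y = ⟦ allowedMult (suc (suc y)) ⟧
      P : ℤ
      P = ∑[ y < ℓ ] (W y * τ (suc (suc y)))
      reassoc : ∀ σ w x → - (σ * w) * x ≡ - (σ * (w * x))
      reassoc = solve-∀
      regroup : ∀ a σ x → 0ℤ + (a + - (σ * x)) ≡ a - σ * (0ℤ + (0ℤ + x))
      regroup = solve-∀
      high : ∑[ y < ℓ ] (headWeight s (suc (suc y)) * τ (suc (suc y))) ≡ - (sign s * P)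
      high = trans (∑<-cong ℓ (λ y → reassoc (sign s) (W y) (τ (suc (suc y)))))
                   (trans (∑<-neg ℓ (λ y → sign s * (W y * τ (suc (suc y)))))
                          (cong -_ (∑<-* ℓ (sign s) (λ y → W y * τ (suc (suc y))))))

  ∣ᵇ⇒p∸r≤ᵇ : ∀ K → p ∣ᵇ (suc K ℕ.+ r) ≡ true → (p ∸ r ≤ᵇ suc K) ≡ true
  ∣ᵇ⇒p∸r≤ᵇ K eq =
    Equivalence.to T-≡ (ℕₚ.≤⇒≤ᵇ (ℕₚ.m≤n+o⇒m∸n≤o p r (subst (p ≤_) (ℕₚ.+-comm (suc K) r) (∣⇒≤ (∣ᵇ⇒∣ eq)))))

  negResidue-pos : ∀ K → negResidue (suc K) ≡ p ∣ᵇ (suc K ℕ.+ r)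
  negResidue-pos K = absorb (p ∸ r ≤ᵇ suc K) (p ∣ᵇ (suc K ℕ.+ r)) (∣ᵇ⇒p∸r≤ᵇ K)
    where
      absorb : ∀ a b → (b ≡ true → a ≡ true) → a ∧ b ≡ b
      absorb a false _   = ∧-zeroʳ a
      absorb a true  b⇒a = trans (∧-identityʳ a) (b⇒a refl)

  ∑-term-column : ∀ L t c (D D′ : ℕ → ℤ) → (∀ x → D x ≡ D′ x + D′ (x ℕ.+ suc t)) → D′ (c ℕ.+ suc L ℕ.* suc t) ≡ 0ℤ →
                ∑[ j < L ] term D c (suc j) (suc t) ≡ ⟦ p ∣ᵇ (suc t ℕ.+ r) ⟧ * D′ (c ℕ.+ suc t ℕ.* 1)
  ∑-term-column L t c D D′ D-split v-end≡0 = begin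
      ∑[ j < L ] (R * (sign (suc j) * D (c ℕ.+ suc j ℕ.* s)))
    ≡⟨ ∑<-cong L (λ j → cong (λ z → R * (sign (suc j) * z)) (split j)) ⟩
      ∑[ j < L ] (R * (sign (suc j) * (v j + v (suc j))))
    ≡⟨ ∑<-* L R (λ j → sign (suc j) * (v j + v (suc j))) ⟩
      R * ∑[ j < L ] (sign (suc j) * (v j + v (suc j)))
    ≡⟨ cong (R *_) (∑-alternating-telescope L v) ⟩
      R * (v 0 + sign L * v L)
    ≡⟨ cong (λ z → R * (v 0 + sign L * z)) v-end≡0 ⟩
      R * (v 0 + sign L * 0ℤ)
    ≡⟨ cong (R *_) (trans (cong (_+_ (v 0)) (ℤ.*-zeroʳ (sign L))) (ℤ.+-identityʳ (v 0))) ⟩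
      R * v 0
    ≡⟨ cong₂ (λ b z → ⟦ b ⟧ * D′ (c ℕ.+ z)) (negResidue-pos t) (ℕₚ.*-comm 1 s) ⟩
      ⟦ p ∣ᵇ (s ℕ.+ r) ⟧ * D′ (c ℕ.+ s ℕ.* 1)
    ∎
    where
      open ≡-Reasoning
      s : ℕ
      s = suc t
      R : ℤ
      R = ⟦ negResidue s ⟧
      v : ℕ → ℤ
      v i = D′ (c ℕ.+ suc i ℕ.* s)
      step : ∀ j → c ℕ.+ suc j ℕ.* s ℕ.+ s ≡ c ℕ.+ suc (suc j) ℕ.* s
      step j = trans (ℕₚ.+-assoc c (suc j ℕ.* s) s) (cong (c ℕ.+_) (ℕₚ.+-comm (suc j ℕ.* s) s))
      split : ∀ j → D (c ℕ.+ suc j ℕ.* s) ≡ v j + v (suc j)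
      split j = trans (D-split _) (cong (λ y → v j + D′ y) (step j))

  module _ (2≤p∸r : 2 ≤ p ∸ r) where

    negResidue-small : ∀ {K} → K < 2 → negResidue K ≡ false
    negResidue-small K<2 rewrite <⇒≤ᵇ≡false (ℕₚ.<-≤-trans K<2 2≤p∸r) = refl

    allowedMult-split : ∀ x → ⟦ allowedMult (suc x) ⟧ ≡ ⟦ negResidue (suc x) ⟧ + ⟦ negResidue x ⟧
    allowedMult-split zero
      rewrite negResidue-small {1} (s≤s (s≤s z≤n)) | negResidue-small {0} (s≤s z≤n) = refl
    allowedMult-split (suc y) =
      iverson-∧-∨ (p ∸ r ≤ᵇ suc (suc y)) (p ∸ r ≤ᵇ suc y) (p ∣ᵇ (suc (suc y) ℕ.+ r)) (p ∣ᵇ (suc y ℕ.+ r))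
                  mono consecutive (∣ᵇ⇒p∸r≤ᵇ y)
      where
        mono : (p ∸ r ≤ᵇ suc y) ≡ true → (p ∸ r ≤ᵇ suc (suc y)) ≡ true
        mono le = Equivalence.to T-≡ (ℕₚ.≤⇒≤ᵇ (ℕₚ.m≤n⇒m≤1+n (ℕₚ.≤ᵇ⇒≤ (p ∸ r) (suc y) (Equivalence.from T-≡ le))))
        consecutive : p ∣ᵇ (suc (suc y) ℕ.+ r) ≡ true → p ∣ᵇ (suc y ℕ.+ r) ≡ true → ⊥
        consecutive A B = 2≰1 (subst (2 ≤_) p≡1 (ℕₚ.≤-trans 2≤p∸r (ℕₚ.m∸n≤m p r)))
          where
            p≡1 : p ≡ 1
            p≡1 = ∣1⇒≡1 (∣m+n∣m⇒∣n (subst (p ∣_) (ℕₚ.+-comm 1 (suc y ℕ.+ r)) (∣ᵇ⇒∣ A)) (∣ᵇ⇒∣ B))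
            2≰1 : ¬ (2 ≤ 1)
            2≰1 (s≤s ())

    ∑-allowedMult : ∀ L (τ : ℕ → ℤ) → τ (suc L) ≡ 0ℤ →
                    ∑[ i < L ] (⟦ negResidue (suc i) ⟧ * (τ (suc i) + τ (suc (suc i))))
                      ≡ ∑[ x < suc L ] (⟦ allowedMult x ⟧ * τ x)
    ∑-allowedMult L τ τ-end≡0 = begin
        ∑[ i < L ] (R (suc i) * (τ (suc i) + τ (suc (suc i))))
      ≡⟨ trans (∑<-cong L (λ i → ℤ.*-distribˡ-+ (R (suc i)) (τ (suc i)) (τ (suc (suc i)))))
               (∑<-+ L (λ i → R (suc i) * τ (suc i)) (λ i → R (suc i) * τ (suc (suc i)))) ⟩
        ∑[ i < L ] (R (suc i) * τ (suc i)) + ∑[ i < L ] (R (suc i) * τ (suc (suc i)))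
      ≡⟨ cong (_+_ (∑[ i < L ] (R (suc i) * τ (suc i)))) (sym (∑<-shift L g g0≡0 gL≡0)) ⟩
        ∑[ i < L ] (R (suc i) * τ (suc i)) + ∑[ i < L ] (R i * τ (suc i))
      ≡⟨ sym (∑<-+ L (λ i → R (suc i) * τ (suc i)) g) ⟩
        ∑[ i < L ] (R (suc i) * τ (suc i) + R i * τ (suc i))
      ≡⟨ ∑<-cong L (λ i → sym (trans (cong (_* τ (suc i)) (allowedMult-split i))
                                     (ℤ.*-distribʳ-+ (τ (suc i)) (R (suc i)) (R i)))) ⟩
        ∑[ i < L ] (⟦ allowedMult (suc i) ⟧ * τ (suc i))
      ≡⟨ sym (ℤ.+-identityˡ _) ⟩
        ∑[ x < suc L ] (⟦ allowedMult x ⟧ * τ x)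
      ∎
      where
        open ≡-Reasoning
        R : ℕ → ℤ
        R K = ⟦ negResidue K ⟧
        g : ℕ → ℤ
        g i = R i * τ (suc i)
        g0≡0 : g 0 ≡ 0ℤ
        g0≡0 rewrite negResidue-small {0} (s≤s z≤n) = refl
        gL≡0 : g L ≡ 0ℤ
        gL≡0 = trans (cong (R L *_) τ-end≡0) (ℤ.*-zeroʳ (R L))

    ∑-term-row : ∀ L s c (D D′ : ℕ → ℤ) → (∀ x → D x ≡ D′ x + D′ (x ℕ.+ s)) → D′ (c ℕ.+ s ℕ.* suc L) ≡ 0ℤ →
                  ∑[ K < L ] term D c s (suc K) ≡ sign s * ∑[ x < suc L ] (⟦ allowedMult x ⟧ * D′ (c ℕ.+ s ℕ.* x))
    ∑-term-row L s c D D′ D-split τ-end≡0 = begin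
        ∑[ K < L ] (R K * (sign s * D (c ℕ.+ s ℕ.* suc K)))
      ≡⟨ ∑<-cong L (λ K → trans (cong (λ z → R K * (sign s * z)) (split K))
                               (swap (R K) (sign s) (τ (suc K) + τ (suc (suc K))))) ⟩
        ∑[ K < L ] (sign s * (R K * (τ (suc K) + τ (suc (suc K)))))
      ≡⟨ ∑<-* L (sign s) (λ K → R K * (τ (suc K) + τ (suc (suc K)))) ⟩
        sign s * ∑[ K < L ] (R K * (τ (suc K) + τ (suc (suc K))))
      ≡⟨ cong (sign s *_) (∑-allowedMult L τ τ-end≡0) ⟩
        sign s * ∑[ x < suc L ] (⟦ allowedMult x ⟧ * τ x)
      ∎
      where
        open ≡-Reasoning
        R : ℕ → ℤ
        R K = ⟦ negResidue (suc K) ⟧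
        τ : ℕ → ℤ
        τ x = D′ (c ℕ.+ s ℕ.* x)
        swap : ∀ a σ z → a * (σ * z) ≡ σ * (a * z)
        swap = solve-∀
        step : ∀ K → c ℕ.+ s ℕ.* suc K ℕ.+ s ≡ c ℕ.+ s ℕ.* suc (suc K)
        step K = trans (ℕₚ.+-assoc c (s ℕ.* suc K) s)
                       (cong (c ℕ.+_) (trans (ℕₚ.+-comm (s ℕ.* suc K) s) (sym (ℕₚ.*-suc s (suc K)))))
        split : ∀ K → D (c ℕ.+ s ℕ.* suc K) ≡ τ (suc K) + τ (suc (suc K))
        split K = trans (D-split _) (cong (λ y → τ (suc K) + D′ y) (step K))

module Counting (p r : ℕ) (2≤p∸r : 2 ≤ p ∸ r) (ℓ : ℕ) where

  open import Data.Integer using (_+_; _*_; 0ℤ)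

  open Sums
  open Weights p r

  n : ℕ
  n = suc ℓ

  -- G summed over the multiplicity vectors (entries ≤ n) of the parts s, …, s + k − 1 of total size n − c;
  -- c is the size taken by the parts below s, and the sum is 0 when c > n
  tailSum : (List (ℕ × ℕ) → ℤ) → ℕ → ℕ → ℕ → ℤ
  tailSum G s k c = ∑[ v ∈ allVecs k n ] (if c ℕ.+ size (entries s v) ≡ᵇ n then G (entries s v) else 0ℤ)

  distincts : ℕ → ℕ → ℕ → ℤ
  distincts = tailSum (λ e → ⟦ isDistinct e ⟧)

  module _ (s k c : ℕ) where

    tailSum-cong : ∀ {G H} → (∀ e → G e ≡ H e) → tailSum G s k c ≡ tailSum H s k c
    tailSum-cong G≗H = ∑ₗ-cong (allVecs k n)
      (λ v → cong (λ z → if c ℕ.+ size (entries s v) ≡ᵇ n then z else 0ℤ) (G≗H (entries s v)))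

    tailSum-+ : ∀ G H → tailSum (λ e → G e + H e) s k c ≡ tailSum G s k c + tailSum H s k c
    tailSum-+ G H = trans
      (∑ₗ-cong (allVecs k n) (λ v → if-+ (c ℕ.+ size (entries s v) ≡ᵇ n) (G (entries s v)) (H (entries s v))))
      (∑ₗ-+ (allVecs k n) _ _)

    tailSum-* : ∀ a G → tailSum (λ e → a * G e) s k c ≡ a * tailSum G s k c
    tailSum-* a G = trans
      (∑ₗ-cong (allVecs k n) (λ v → if-* (c ℕ.+ size (entries s v) ≡ᵇ n) a (G (entries s v))))
      (∑ₗ-* (allVecs k n) a _)

    tailSum-zero : tailSum (λ _ → 0ℤ) s k c ≡ 0ℤ
    tailSum-zero =
      trans (∑ₗ-cong (allVecs k n) (λ v → if-same (c ℕ.+ size (entries s v) ≡ᵇ n) 0ℤ)) (∑ₗ-zero (allVecs k n))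

    tailSum-vanishes : ∀ G → n < c → tailSum G s k c ≡ 0ℤ
    tailSum-vanishes G n<c = trans (∑ₗ-cong (allVecs k n) vanish) (∑ₗ-zero (allVecs k n))
      where
        vanish : ∀ v → (if c ℕ.+ size (entries s v) ≡ᵇ n then G (entries s v) else 0ℤ) ≡ 0ℤ
        vanish v with c ℕ.+ size (entries s v) ≡ᵇ n in eq
        ... | false = refl
        ... | true  = ⊥-elim (ℕₚ.<⇒≱ n<c (subst (c ≤_) (ℕₚ.≡ᵇ⇒≡ _ n (Equivalence.from T-≡ eq)) (ℕₚ.m≤m+n c _)))

  tailSum-suc : ∀ G s k c →
                tailSum G s (suc k) c ≡ ∑[ x < suc n ] tailSum (λ e → G ((s , x) ∷ e)) (suc s) k (c ℕ.+ s ℕ.* x)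
  tailSum-suc G s k c = begin
      ∑ₗ (allVecs (suc k) n) F
    ≡⟨ ∑ₗ-concatMap (upTo (suc n)) (λ x → map (x Vec.∷_) (allVecs k n)) F ⟩
      ∑[ x ∈ upTo (suc n) ] ∑ₗ (map (x Vec.∷_) (allVecs k n)) F
    ≡⟨ ∑ₗ-upTo (suc n) (λ x → ∑ₗ (map (x Vec.∷_) (allVecs k n)) F) ⟩
      ∑[ x < suc n ] ∑ₗ (map (x Vec.∷_) (allVecs k n)) F
    ≡⟨ ∑<-cong (suc n) (λ x → trans (∑ₗ-map (allVecs k n) (x Vec.∷_) F) (∑ₗ-cong (allVecs k n) (reassoc x))) ⟩
      ∑[ x < suc n ] tailSum (λ e → G ((s , x) ∷ e)) (suc s) k (c ℕ.+ s ℕ.* x)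
    ∎
    where
      open ≡-Reasoning
      F : Vec.Vec ℕ (suc k) → ℤ
      F v = if c ℕ.+ size (entries s v) ≡ᵇ n then G (entries s v) else 0ℤ
      reassoc : ∀ x v → F (x Vec.∷ v) ≡ (if c ℕ.+ s ℕ.* x ℕ.+ size (entries (suc s) v) ≡ᵇ n
                                         then G ((s , x) ∷ entries (suc s) v) else 0ℤ)
      reassoc x v = cong (λ m → if m ≡ᵇ n then G ((s , x) ∷ entries (suc s) v) else 0ℤ)
                         (sym (ℕₚ.+-assoc c (s ℕ.* x) (size (entries (suc s) v))))

  tailSum-split : ∀ G (H : ℕ → ℤ) s k c →
                  (∀ x e → G ((s , x) ∷ e) ≡ (if x ≤ᵇ 1 then G e else 0ℤ) + H x * ⟦ isDistinct e ⟧) →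
                  tailSum G s (suc k) c
                    ≡ (tailSum G (suc s) k c + tailSum G (suc s) k (c ℕ.+ s))
                      + ∑[ x < suc n ] (H x * distincts (suc s) k (c ℕ.+ s ℕ.* x))
  tailSum-split G H s k c G-∷ = begin
      tailSum G s (suc k) c
    ≡⟨ tailSum-suc G s k c ⟩
      ∑[ x < suc n ] tailSum (λ e → G ((s , x) ∷ e)) (suc s) k (c ℕ.+ s ℕ.* x)
    ≡⟨ ∑<-cong (suc n) expand ⟩
      ∑[ x < suc n ] (gated x + H x * distincts (suc s) k (c ℕ.+ s ℕ.* x))
    ≡⟨ ∑<-+ (suc n) gated (λ x → H x * distincts (suc s) k (c ℕ.+ s ℕ.* x)) ⟩
      ∑< (suc n) gated + ∑[ x < suc n ] (H x * distincts (suc s) k (c ℕ.+ s ℕ.* x))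
    ≡⟨ cong (λ z → z + ∑[ x < suc n ] (H x * distincts (suc s) k (c ℕ.+ s ℕ.* x))) low ⟩
      (tailSum G (suc s) k c + tailSum G (suc s) k (c ℕ.+ s))
        + ∑[ x < suc n ] (H x * distincts (suc s) k (c ℕ.+ s ℕ.* x))
    ∎
    where
      open ≡-Reasoning
      gated : ℕ → ℤ
      gated x = tailSum (λ e → if x ≤ᵇ 1 then G e else 0ℤ) (suc s) k (c ℕ.+ s ℕ.* x)
      expand : ∀ x → tailSum (λ e → G ((s , x) ∷ e)) (suc s) k (c ℕ.+ s ℕ.* x)
                     ≡ gated x + H x * distincts (suc s) k (c ℕ.+ s ℕ.* x)
      expand x = let c′ = c ℕ.+ s ℕ.* x in
        trans (tailSum-cong (suc s) k c′ (G-∷ x))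
              (trans (tailSum-+ (suc s) k c′ (λ e → if x ≤ᵇ 1 then G e else 0ℤ) (λ e → H x * ⟦ isDistinct e ⟧))
                     (cong (_+_ (gated x)) (tailSum-* (suc s) k c′ (H x) (λ e → ⟦ isDistinct e ⟧))))
      c+s*0≡c : c ℕ.+ s ℕ.* 0 ≡ c
      c+s*0≡c = trans (cong (c ℕ.+_) (ℕₚ.*-zeroʳ s)) (ℕₚ.+-identityʳ c)
      low : ∑< (suc n) gated ≡ tailSum G (suc s) k c + tailSum G (suc s) k (c ℕ.+ s)
      low = cong₂ _+_
        (cong (tailSum G (suc s) k) c+s*0≡c)
        (trans (cong₂ _+_ (cong (λ c′ → tailSum G (suc s) k (c ℕ.+ c′)) (ℕₚ.*-identityʳ s))
                          (trans (∑<-cong ℓ (λ y → tailSum-zero (suc s) k (c ℕ.+ s ℕ.* suc (suc y)))) (∑<-zero ℓ)))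
               (ℤ.+-identityʳ _))

  distincts-split : ∀ s k c → distincts s (suc k) c ≡ distincts (suc s) k c + distincts (suc s) k (c ℕ.+ s)
  distincts-split s k c =
    trans (tailSum-split (λ e → ⟦ isDistinct e ⟧) (λ _ → 0ℤ) s k c (λ x e → gate (x ≤ᵇ 1) (isDistinct e)))
          (trans (cong (_+_ (distincts (suc s) k c + distincts (suc s) k (c ℕ.+ s))) (∑<-zero (suc n)))
                 (ℤ.+-identityʳ _))
    where
      gate : ∀ b d → ⟦ b ∧ d ⟧ ≡ (if b then ⟦ d ⟧ else 0ℤ) + 0ℤ * ⟦ d ⟧
      gate true  d = sym (ℤ.+-identityʳ ⟦ d ⟧)
      gate false d = refl

  invariant : ℕ → (ℕ → ℤ) → ℕ → ℤ
  invariant t D c = cutSum n (λ j K → term D c (suc j) (suc K)) t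

  invariant-linear : ∀ t a c {D D′ : ℕ → ℤ} → (∀ x → D x ≡ D′ x + D′ (x ℕ.+ a)) →
                     invariant t D c ≡ invariant t D′ c + invariant t D′ (c ℕ.+ a)
  invariant-linear t a c {D} {D′} D-split =
    trans (cutSum-cong n t split)
          (cutSum-+ n t (λ j K → term D′ c (suc j) (suc K)) (λ j K → term D′ (c ℕ.+ a) (suc j) (suc K)))
    where
      distrib : ∀ u σ x y → u * (σ * (x + y)) ≡ u * (σ * x) + u * (σ * y)
      distrib = solve-∀
      shift : ∀ m → c ℕ.+ m ℕ.+ a ≡ c ℕ.+ a ℕ.+ m
      shift m = trans (ℕₚ.+-assoc c m a) (trans (cong (c ℕ.+_) (ℕₚ.+-comm m a)) (sym (ℕₚ.+-assoc c a m)))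
      split : ∀ j K → term D c (suc j) (suc K) ≡ term D′ c (suc j) (suc K) + term D′ (c ℕ.+ a) (suc j) (suc K)
      split j K = let m = suc j ℕ.* suc K in
        trans (cong (λ z → ⟦ negResidue (suc K) ⟧ * (sign (suc j) * z))
                    (trans (D-split (c ℕ.+ m)) (cong (λ y → D′ (c ℕ.+ m) + D′ y) (shift m))))
              (distrib ⟦ negResidue (suc K) ⟧ (sign (suc j)) (D′ (c ℕ.+ m)) (D′ (c ℕ.+ a ℕ.+ m)))

  ∑-headWeight-distincts : ∀ t k c →
    ∑[ x < suc n ] (headWeight (suc t) x * distincts (suc (suc t)) k (c ℕ.+ suc t ℕ.* x))
      ≡ ∑[ j < n ] term (distincts (suc t) (suc k)) c (suc j) (suc t)
        - ∑[ K < n ] term (distincts (suc t) (suc k)) c (suc t) (suc K)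
  ∑-headWeight-distincts t k c =
    trans (∑-headWeight ℓ s (λ x → D′ (c ℕ.+ s ℕ.* x)))
          (sym (cong₂ _-_ (∑-term-column n t c D D′ D-split (beyond (ℕₚ.m≤m*n (suc n) s)))
                          (∑-term-row 2≤p∸r n s c D D′ D-split (beyond (ℕₚ.m≤n*m (suc n) s)))))
    where
      s = suc t
      D = distincts s (suc k)
      D′ = distincts (suc s) k
      D-split : ∀ x → D x ≡ D′ x + D′ (x ℕ.+ s)
      D-split = distincts-split s k
      beyond : ∀ {m} → n < m → D′ (c ℕ.+ m) ≡ 0ℤ
      beyond {m} n<m = tailSum-vanishes (suc s) k (c ℕ.+ m) (λ e → ⟦ isDistinct e ⟧) (ℕₚ.≤-trans n<m (ℕₚ.m≤n+m m c))

  tailSum-weight≡invariant : ∀ k t → t ℕ.+ k ≡ n → ∀ c →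
                             tailSum weight (suc t) k c ≡ invariant t (distincts (suc t) k) c
  tailSum-weight≡invariant zero t t+0≡n c rewrite trans (sym (ℕₚ.+-identityʳ t)) t+0≡n =
    trans (trans (ℤ.+-identityʳ _) (if-same (c ℕ.+ 0 ≡ᵇ n) 0ℤ))
          (sym (cutSum-full n (λ j K → term (distincts (suc n) 0) c (suc j) (suc K))))
  tailSum-weight≡invariant (suc k) t t+k+1≡n c = begin
      tailSum weight s (suc k) c
    ≡⟨ tailSum-split weight (headWeight s) s k c (weight-∷ s) ⟩
      (tailSum weight (suc s) k c + tailSum weight (suc s) k (c ℕ.+ s)) + Ψ
    ≡⟨ cong (λ z → z + Ψ) (cong₂ _+_ (tailSum-weight≡invariant k s s+k≡n c)
                                      (tailSum-weight≡invariant k s s+k≡n (c ℕ.+ s))) ⟩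
      (invariant s D′ c + invariant s D′ (c ℕ.+ s)) + Ψ
    ≡⟨ cong (λ z → z + Ψ) (sym (invariant-linear s s c {D} {D′} (distincts-split s k))) ⟩
      invariant s D c + Ψ
    ≡⟨ cong (_+_ (invariant s D c)) (∑-headWeight-distincts t k c) ⟩
      invariant s D c + (∑[ j < n ] term D c (suc j) s - ∑[ K < n ] term D c s (suc K))
    ≡⟨ sym (cutSum-suc n (λ j K → term D c (suc j) (suc K)) t t<n) ⟩
      invariant t D c
    ∎
    where
      open ≡-Reasoning
      s = suc t
      D = distincts s (suc k)
      D′ = distincts (suc s) k
      Ψ = ∑[ x < suc n ] (headWeight s x * D′ (c ℕ.+ s ℕ.* x))
      s+k≡n : s ℕ.+ k ≡ n
      s+k≡n = trans (sym (ℕₚ.+-suc t k)) t+k+1≡n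
      t<n : t < n
      t<n = subst (t <_) t+k+1≡n (ℕₚ.m<m+n t (s≤s z≤n))

  ∑-weight-vanishes : ∑[ e ∈ partitions n ] weight e ≡ 0ℤ
  ∑-weight-vanishes = begin
      ∑ₗ (partitions n) weight
    ≡⟨ ∑ₗ-filterᵇ (map (entries 1) (allVecs n n)) (λ e → size e ≡ᵇ n) weight ⟩
      ∑[ e ∈ map (entries 1) (allVecs n n) ] (if size e ≡ᵇ n then weight e else 0ℤ)
    ≡⟨ ∑ₗ-map (allVecs n n) (entries 1) (λ e → if size e ≡ᵇ n then weight e else 0ℤ) ⟩
      tailSum weight 1 n 0
    ≡⟨ tailSum-weight≡invariant n 0 refl 0 ⟩
      invariant 0 (distincts 1 n) 0
    ≡⟨ cutSum-zero n (λ j K → term (distincts 1 n) 0 (suc j) (suc K)) ⟩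
      0ℤ
    ∎
    where open ≡-Reasoning

open import Data.Nat using (_+_)

theorem2 : (p r : ℕ) → r + 2 ≤ p → (n : ℕ) → 1 ≤ n →
    + a r n p ≡ + g-o r n p - + g-e r n p
theorem2 p r r+2≤p zero ()
theorem2 p r r+2≤p n@(suc ℓ) _ =
  ℤ.i-j≡0⇒i≡j (+ a r n p) (+ g-o r n p - + g-e r n p) (trans (sym (∑-weight n)) ∑-weight-vanishes)
  where
    2≤p∸r : 2 ≤ p ∸ r
    2≤p∸r = subst (_≤ p ∸ r) (ℕₚ.m+n∸m≡n r 2) (ℕₚ.∸-monoˡ-≤ r r+2≤p)
    open Weights p r using (∑-weight)
    open Counting p r 2≤p∸r ℓ using (∑-weight-vanishes)
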